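{- For every integer $d \ge 1$ we have $\frac{15}{2^7} 2^d \le f_0(d) \le 2^d$ and $\frac{15}{2^7} 2^d \le f_1(d) \le 2^d$.
   Context: For $h \in \{0,1\}^d$, let $\mathcal{S}_h = \{(x_1, \dotsc, x_d) \in \mathbb{Z}^d : x_1^2 + \dotsb + x_d^2 \le d \text{ and } x_i \equiv h_i \pmod 2 \text{ for all } i\}$. Define $f_0(d) = \min |\mathcal{S}_h|$ over $h \in \{0,1\}^d$ with $h_1 + \dotsb + h_d \equiv d \pmod 2$, and $f_1(d) = \min |\mathcal{S}_h|$ over $h \in \{0,1\}^d$ with $h_1 + \dotsb + h_d \not\equiv d \pmod 2$. -}

module Defs where

open import Data.Nat as ℕ using (ℕ; zero; suc; _%_)
open import Data.Integer as ℤ using (ℤ; +_; _-_)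
open import Data.Bool using (Bool; true; false)
open import Data.Fin using (Fin)
open import Data.Vec as Vec using (Vec; []; _∷_; lookup)
open import Data.List as List using (List; []; _∷_; map; concatMap; upTo; length; filter)
open import Data.Product using (_×_)
open import Relation.Binary.PropositionalEquality using (_≡_)
open import Relation.Nullary using (Dec; ¬?)
open import Relation.Nullary.Decidable using (_×-dec_)
open import Relation.Unary using (Decidable)
import Data.Fin.Properties as FinP
import Data.Nat.Properties as ℕP
import Data.Integer.Properties as ℤP

bit : Bool → ℕ
bit true  = 1
bit false = 0

sumSq : ∀ {n} → Vec ℤ n → ℤ
sumSq []       = + 0
sumSq (x ∷ xs) = x ℤ.* x ℤ.+ sumSq xs

InS : (d : ℕ) → Vec Bool d → Vec ℤ d → Set
InS d h x = (sumSq x ℤ.≤ + d) × (∀ (i : Fin d) → lookup x i ℤ.%ℕ 2 ≡ bit (lookup h i))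

InS? : (d : ℕ) (h : Vec Bool d) → Decidable (InS d h)
InS? d h x = (sumSq x ℤP.≤? + d) ×-dec FinP.all? (λ i → lookup x i ℤ.%ℕ 2 ℕP.≟ bit (lookup h i))

range : ℕ → List ℤ
range k = map (λ i → + i - + k) (upTo (suc (2 ℕ.* k)))

box : (n k : ℕ) → List (Vec ℤ n)
box zero    k = [] ∷ []
box (suc n) k = concatMap (λ a → map (a ∷_) (box n k)) (range k)

-- |S_h|: every element of S_h has |x_i| ≤ x_i² ≤ d, so S_h ⊆ box d d
card-S : (d : ℕ) → Vec Bool d → ℕ
card-S d h = length (filter (InS? d h) (box d d))

allBits : (n : ℕ) → List (Vec Bool n)
allBits zero    = [] ∷ []
allBits (suc n) = concatMap (λ b → map (b ∷_) (allBits n)) (true ∷ false ∷ [])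

weight : ∀ {n} → Vec Bool n → ℕ
weight []       = 0
weight (b ∷ bs) = bit b ℕ.+ weight bs

-- minimum of a list of naturals (0 for the empty list; never used on empty lists for d ≥ 1)
listMin : List ℕ → ℕ
listMin []       = 0
listMin (x ∷ xs) = List.foldr ℕ._⊓_ x xs

f₀ : ℕ → ℕ
f₀ d = listMin (map (card-S d) (filter (λ h → weight h % 2 ℕP.≟ d % 2) (allBits d)))

f₁ : ℕ → ℕ
f₁ d = listMin (map (card-S d) (filter (λ h → ¬? (weight h % 2 ℕP.≟ d % 2)) (allBits d)))

{-# OPTIONS --safe #-}
module Submission where

-- Write S_h(B) for S_h with the bound d replaced by a budget B. The points of S_(b∷h)(B) with
-- first coordinate a are those of S_h(B - a²) when a ≡ b (mod 2), and there are none otherwise.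
--
-- If h has w ones and z zeros, taking ±1 at the odd positions and 0 or ±2 at the
-- even ones, with at most ⌊z/4⌋ entries ±2, gives 2^w U(z, ⌊z/4⌋) points of S_h, where
-- U(z, j) = Σ_{i ≤ j} 2^i C(z, i). So it suffices that 15·2^z ≤ 128 U(z, ⌊z/4⌋). For z < 16 this
-- is checked by evaluation (it is an equality at z = 7). Beyond, the single term T(z, j) = 2^j C(z, j)
-- suffices: T(4j + r + 4, j + 1) ≥ 16 T(4j + r, j) for j ≥ 3, by expanding T(n + 4, j + 2) with
-- Pascal's rule and comparing neighbouring terms through (j + 1) T(n, j + 1) = 2 (n - j) T(n, j).
--
-- For h = (1, …, 1) every point of S_h has all coordinates ±1, and for
-- h = (0, 1, …, 1) the first coordinate must moreover be 0, so both give at most 2^d points;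
-- their weights d and d - 1 have the two parities.

open import Defs
open import Data.Bool using (Bool; true; false)
open import Data.Fin using (Fin; zero; suc; toℕ)
open import Data.Fin.Patterns using (0F; 1F; 2F; 3F)
open import Data.Fin.Properties using (all?)
open import Data.Integer as ℤ using (ℤ; +_; -[1+_]; +≤+; ∣_∣)
import Data.Integer.Properties as ℤ
open import Data.Integer.Tactic.RingSolver using () renaming (solve-∀ to ℤ-solve-∀)
open import Data.List using (List; []; _∷_; [_]; _++_; map; concatMap; length; filter; upTo; applyUpTo)
open import Data.List.Membership.Propositional using (_∈_)
open import Data.List.Membership.Propositional.Properties using (∈-map⁺; ∈-++⁺ˡ; ∈-++⁺ʳ; ∈-filter⁺)
open import Data.List.Properties
  using (filter-++; length-++; filter-none; map-cong; map-++; map-upTo; applyUpTo-∷ʳ;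
         foldr-preservesᵇ; foldr-preservesᵒ)
open import Data.List.Relation.Binary.Sublist.Propositional using (_⊆_; []; _∷_; _∷ʳ_; ⊆-refl; ⊆-trans)
open import Data.List.Relation.Binary.Sublist.Propositional.Properties using (filter⁺; length-mono-≤; ++⁺ʳ)
open import Data.List.Relation.Unary.All as All using (All; _∷_)
import Data.List.Relation.Unary.All.Properties as All
open import Data.List.Relation.Unary.Any as Any using (here; there)
open import Data.Nat
open import Data.Nat.DivMod using (_/_; _mod_; _divMod_; DivMod; m/n*n≤m)
open import Data.Nat.ListAction using (sum)
open import Data.Nat.ListAction.Properties using (sum-++)
open import Data.Nat.Properties
open import Data.Nat.Tactic.RingSolver using (solve-∀)
open import Data.Product using (_×_; _,_)
open import Data.Sum using (_⊎_; inj₁; inj₂; [_,_]′)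
open import Data.Vec using (Vec; []; _∷_; lookup; replicate)
open import Function using (_∘_)
open import Level using (Level)
open import Relation.Binary.PropositionalEquality
  using (_≡_; _≢_; refl; sym; trans; cong; cong₂; subst; subst₂; module ≡-Reasoning)
open import Relation.Nullary using (¬_; does; ¬?)
open import Relation.Nullary.Decidable using (_×-dec_; from-yes)
open import Relation.Unary using (Pred; Decidable) renaming (_⊆_ to _⇒_)

private variable
  a ℓ ℓ′ : Level
  A A′ : Set a

count : {P : Pred A ℓ} → Decidable P → List A → ℕ
count P? xs = length (filter P? xs)

module _ {P : Pred A ℓ} (P? : Decidable P) where

  count-++ : ∀ xs ys → count P? (xs ++ ys) ≡ count P? xs + count P? ys
  count-++ xs ys = trans (cong length (filter-++ P? xs ys)) (length-++ (filter P? xs))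

  count-map : ∀ (f : A′ → A) xs → count P? (map f xs) ≡ count (P? ∘ f) xs
  count-map f []       = refl
  count-map f (x ∷ xs) with does (P? (f x))
  ... | true  = cong suc (count-map f xs)
  ... | false = count-map f xs

  count-concatMap : ∀ (f : A′ → List A) xs → count P? (concatMap f xs) ≡ sum (map (count P? ∘ f) xs)
  count-concatMap f []       = refl
  count-concatMap f (x ∷ xs) =
    trans (count-++ (f x) (concatMap f xs)) (cong (_+_ (count P? (f x))) (count-concatMap f xs))

  count-none : (∀ {x} → ¬ P x) → ∀ xs → count P? xs ≡ 0
  count-none ¬P xs = cong length (filter-none P? (All.universal (λ _ → ¬P) xs))

count-mono : {P : Pred A ℓ} {Q : Pred A ℓ′} (P? : Decidable P) (Q? : Decidable Q) →
             P ⇒ Q → ∀ xs → count P? xs ≤ count Q? xs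
count-mono P? Q? P⇒Q xs = length-mono-≤ (filter⁺ P? Q? (λ { refl → P⇒Q }) (⊆-refl {x = xs}))

sum-map-⊆ : ∀ (g : A → ℕ) {xs ys} → xs ⊆ ys → sum (map g xs) ≤ sum (map g ys)
sum-map-⊆ g []             = z≤n
sum-map-⊆ g (y ∷ʳ xs⊆ys)   = ≤-trans (sum-map-⊆ g xs⊆ys) (m≤n+m _ (g y))
sum-map-⊆ g (refl ∷ xs⊆ys) = +-monoʳ-≤ (g _) (sum-map-⊆ g xs⊆ys)

range-suc : ∀ k → range (suc k) ≡ -[1+ k ] ∷ range k ++ [ + suc k ]
range-suc k = begin
  range (suc k)
    ≡⟨ map-upTo F (suc (2 * suc k)) ⟩
  applyUpTo F (suc (2 * suc k))
    ≡⟨ cong (applyUpTo F ∘ suc) (*-suc 2 k) ⟩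
  F 0 ∷ applyUpTo (F ∘ suc) (suc (suc (2 * k)))
    ≡⟨ cong (F 0 ∷_) (applyUpTo-∷ʳ (F ∘ suc) (suc (2 * k))) ⟨
  F 0 ∷ applyUpTo (F ∘ suc) (suc (2 * k)) ++ [ F (2 + 2 * k) ]
    ≡⟨ cong₂ (λ xs x → F 0 ∷ xs ++ [ x ]) middle last ⟩
  -[1+ k ] ∷ range k ++ [ + suc k ]
    ∎
  where
  open ≡-Reasoning
  F : ℕ → ℤ
  F i = + i ℤ.- + suc k
  shift : ∀ i → F (suc i) ≡ + i ℤ.- + k
  shift i = trans (ℤ.m-n≡m⊖n (suc i) (suc k)) (trans (ℤ.[1+m]⊖[1+n]≡m⊖n i k) (sym (ℤ.m-n≡m⊖n i k)))
  middle : applyUpTo (F ∘ suc) (suc (2 * k)) ≡ range k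
  middle = trans (sym (map-upTo (F ∘ suc) (suc (2 * k)))) (map-cong shift (upTo (suc (2 * k))))
  cancel : ∀ x y → x ℤ.+ y ℤ.- y ≡ x
  cancel = ℤ-solve-∀
  last : F (2 + 2 * k) ≡ + suc k
  last = begin
    F (2 + 2 * k)                ≡⟨ shift (suc (2 * k)) ⟩
    + suc (2 * k) ℤ.- + k        ≡⟨ cong (λ m → + suc m ℤ.- + k) (cong (_+_ k) (+-identityʳ k)) ⟩
    + (suc k + k) ℤ.- + k        ≡⟨ cong (ℤ._- + k) (ℤ.pos-+ (suc k) k) ⟩
    + suc k ℤ.+ + k ℤ.- + k      ≡⟨ cancel (+ suc k) (+ k) ⟩
    + suc k                      ∎

range-⊆ : ∀ {m n} → m ≤′ n → range m ⊆ range n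
range-⊆ ≤′-refl                 = ⊆-refl
range-⊆ {m} (≤′-step {n} m≤′n) =
  subst (range m ⊆_) (sym (range-suc n)) (-[1+ n ] ∷ʳ ++⁺ʳ [ + suc n ] (range-⊆ m≤′n))

sum-⊆-range : ∀ (g : ℤ → ℕ) {as m n} → as ⊆ range m → m ≤ n → sum (map g as) ≤ sum (map g (range n))
sum-⊆-range g as⊆ m≤n = sum-map-⊆ g (⊆-trans as⊆ (range-⊆ (≤⇒≤′ m≤n)))

sum-range-supported : ∀ (g : ℤ → ℕ) {m n} → (∀ a → m < ∣ a ∣ → g a ≡ 0) → m ≤′ n →
                      sum (map g (range n)) ≡ sum (map g (range m))
sum-range-supported g     vanish ≤′-refl             = refl
sum-range-supported g {m} vanish (≤′-step {n} m≤′n) = begin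
  sum (map g (range (suc n)))                               ≡⟨ cong (sum ∘ map g) (range-suc n) ⟩
  g -[1+ n ] + sum (map g (range n ++ [ + suc n ]))         ≡⟨ cong (_+_ (g -[1+ n ])) ends ⟩
  g -[1+ n ] + (σ + (g (+ suc n) + 0))
    ≡⟨ cong₂ (λ u v → u + (σ + (v + 0))) (vanish -[1+ n ] m<1+n) (vanish (+ suc n) m<1+n) ⟩
  σ + 0                                                     ≡⟨ +-identityʳ σ ⟩
  σ                                                         ≡⟨ sum-range-supported g vanish m≤′n ⟩
  sum (map g (range m))                                     ∎
  where
  open ≡-Reasoning
  σ = sum (map g (range n))
  ends : sum (map g (range n ++ [ + suc n ])) ≡ σ + (g (+ suc n) + 0)
  ends = trans (cong sum (map-++ g (range n) _)) (sum-++ (map g (range n)) _)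
  m<1+n : m < suc n
  m<1+n = s≤s (≤′⇒≤ m≤′n)

-- T n j = 2^j C(n, j) and U n j = Σ_{i ≤ j} T n i count the vectors of {0, ±2}^n with exactly,
-- respectively at most, j nonzero entries.
T : ℕ → ℕ → ℕ
T _       zero    = 1
T zero    (suc j) = 0
T (suc n) (suc j) = T n (suc j) + 2 * T n j

U : ℕ → ℕ → ℕ
U _       zero    = 1
U zero    (suc j) = 1
U (suc n) (suc j) = U n (suc j) + 2 * U n j

T≤U : ∀ n j → T n j ≤ U n j
T≤U _       zero    = ≤-refl
T≤U zero    (suc j) = z≤n
T≤U (suc n) (suc j) = +-mono-≤ (T≤U n (suc j)) (*-monoʳ-≤ 2 (T≤U n j))

T-mono : ∀ n j → T n j ≤ T (suc n) j
T-mono _       zero    = ≤-refl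
T-mono zero    (suc j) = z≤n
T-mono (suc n) (suc j) = m≤m+n _ _

T-vanish : ∀ {n j} → n < j → T n j ≡ 0
T-vanish {zero}  {suc j} _         = refl
T-vanish {suc n} {suc j} (s≤s n<j) =
  cong₂ (λ a b → a + 2 * b) (T-vanish (m<n⇒m<1+n n<j)) (T-vanish n<j)

T-one : ∀ n → T n 1 ≡ 2 * n
T-one zero    = refl
T-one (suc n) = trans (cong (_+ 2) (T-one n)) (trans (+-comm (2 * n) 2) (sym (*-suc 2 n)))

T-ratio : ∀ s j → suc j * T (s + j) (suc j) ≡ 2 * s * T (s + j) j
T-ratio zero    j       = trans (cong (suc j *_) (T-vanish (n<1+n j))) (*-zeroʳ (suc j))
T-ratio (suc s) zero    = begin
  1 * T (suc s + 0) 1  ≡⟨ *-identityˡ _ ⟩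
  T (suc s + 0) 1      ≡⟨ T-one (suc s + 0) ⟩
  2 * (suc s + 0)      ≡⟨ cong (2 *_) (+-identityʳ (suc s)) ⟩
  2 * suc s            ≡⟨ *-identityʳ (2 * suc s) ⟨
  2 * suc s * 1        ∎
  where open ≡-Reasoning
T-ratio (suc s) (suc j) = begin
  suc (suc j) * (Y + 2 * X)                  ≡⟨ expand Y X j ⟩
  suc (suc j) * Y + 2 * X + 2 * (suc j * X)  ≡⟨ cong₂ (λ u v → u + 2 * X + 2 * v) (T-ratio s (suc j)) ratio ⟩
  2 * s * X + 2 * X + 2 * (2 * suc s * Z)    ≡⟨ collect s X Z ⟩
  2 * suc s * (X + 2 * Z)                    ∎
  where
  open ≡-Reasoning
  n = s + suc j
  Y = T n (2 + j)
  X = T n (1 + j)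
  Z = T n j
  ratio : suc j * X ≡ 2 * suc s * Z
  ratio = subst (λ m → suc j * T m (suc j) ≡ 2 * suc s * T m j) (sym (+-suc s j)) (T-ratio (suc s) j)
  expand : ∀ a b j → suc (suc j) * (a + 2 * b) ≡ suc (suc j) * a + 2 * b + 2 * (suc j * b)
  expand = solve-∀
  collect : ∀ s b c → 2 * s * b + 2 * b + 2 * (2 * suc s * c) ≡ 2 * suc s * (b + 2 * c)
  collect = solve-∀

T-double-step : ∀ n j → T (2 + n) (2 + j) ≡ T n (2 + j) + 4 * T n (1 + j) + 4 * T n j
T-double-step n j = collect (T n (2 + j)) (T n (1 + j)) (T n j)
  where
  collect : ∀ a b c → a + 2 * b + 2 * (b + 2 * c) ≡ a + 4 * b + 4 * c
  collect = solve-∀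

T-double-step-≥ : ∀ n j → T n (1 + j) + 4 * T n j ≤ T (2 + n) (1 + j)
T-double-step-≥ n j = begin
  T n (1 + j) + 4 * T n j                    ≡⟨ split (T n (1 + j)) (T n j) ⟩
  T n (1 + j) + 2 * T n j + 2 * T n j        ≤⟨ +-monoʳ-≤ (T n (1 + j) + 2 * T n j) (*-monoʳ-≤ 2 (T-mono n j)) ⟩
  T n (1 + j) + 2 * T n j + 2 * T (1 + n) j  ∎
  where
  open ≤-Reasoning
  split : ∀ b c → b + 4 * c ≡ b + 2 * c + 2 * c
  split = solve-∀

T-quadruple-step-≥ : ∀ n j → T n (2 + j) + 8 * T n (1 + j) + 24 * T n j ≤ T (4 + n) (2 + j)
T-quadruple-step-≥ n j = begin
  T n (2 + j) + 8 * T n (1 + j) + 24 * T n j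
    ≡⟨ regroup (T n (2 + j)) (T n (1 + j)) (T n j) ⟩
  (T n (2 + j) + 4 * T n (1 + j) + 4 * T n j) + 4 * (T n (1 + j) + 4 * T n j) + 4 * T n j
    ≤⟨ +-mono-≤ (+-mono-≤ (≤-reflexive (sym (T-double-step n j))) (*-monoʳ-≤ 4 (T-double-step-≥ n j)))
                (*-monoʳ-≤ 4 (≤-trans (T-mono n j) (T-mono (1 + n) j))) ⟩
  T (2 + n) (2 + j) + 4 * T (2 + n) (1 + j) + 4 * T (2 + n) j
    ≡⟨ T-double-step (2 + n) j ⟨
  T (4 + n) (2 + j) ∎
  where
  open ≤-Reasoning
  regroup : ∀ a b c → a + 8 * b + 24 * c ≡ (a + 4 * b + 4 * c) + 4 * (b + 4 * c) + 4 * c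
  regroup = solve-∀

-- Multiplied by (2 + i) * (2 * (1 + s)) and rewritten with T-ratio twice, the claim becomes the hypothesis.
T-middle : ∀ s i → 16 * (2 + i) * (1 + s) ≤ 4 * (1 + s) * s + 24 * (2 + i) * (1 + i) →
           8 * T (s + suc i) (suc i) ≤ T (s + suc i) (suc (suc i)) + 24 * T (s + suc i) i
T-middle s i poly = *-cancelˡ-≤ M (begin
  M * (8 * X)                                         ≡⟨ e₁ s i X ⟩
  (16 * (2 + i) * (1 + s)) * X                        ≤⟨ *-monoˡ-≤ X poly ⟩
  (4 * (1 + s) * s + 24 * (2 + i) * (1 + i)) * X      ≡⟨ e₂ s i X ⟩
  2 * (1 + s) * (2 * s * X) + 24 * (2 + i) * ((1 + i) * X)
    ≡⟨ cong₂ (λ u v → 2 * (1 + s) * u + 24 * (2 + i) * v) (sym (T-ratio s (suc i))) ratio ⟩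
  2 * (1 + s) * ((2 + i) * Y) + 24 * (2 + i) * (2 * (1 + s) * Z) ≡⟨ e₃ s i Y Z ⟩
  M * (Y + 24 * Z)                                    ∎)
  where
  open ≤-Reasoning
  n = s + suc i
  X = T n (suc i)
  Y = T n (suc (suc i))
  Z = T n i
  M = (2 + i) * (2 * (1 + s))
  ratio : (1 + i) * X ≡ 2 * (1 + s) * Z
  ratio = subst (λ m → suc i * T m (suc i) ≡ 2 * suc s * T m i) (sym (+-suc s i)) (T-ratio (suc s) i)
  e₁ : ∀ s i x → (2 + i) * (2 * (1 + s)) * (8 * x) ≡ (16 * (2 + i) * (1 + s)) * x
  e₁ = solve-∀
  e₂ : ∀ s i x → (4 * (1 + s) * s + 24 * (2 + i) * (1 + i)) * x
                ≡ 2 * (1 + s) * (2 * s * x) + 24 * (2 + i) * ((1 + i) * x)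
  e₂ = solve-∀
  e₃ : ∀ s i y z → 2 * (1 + s) * ((2 + i) * y) + 24 * (2 + i) * (2 * (1 + s) * z)
                  ≡ (2 + i) * (2 * (1 + s)) * (y + 24 * z)
  e₃ = solve-∀

T-growth : ∀ j r → 3 ≤ j → 16 * T (j * 4 + r) j ≤ T (suc j * 4 + r) (suc j)
T-growth 0 r ()
T-growth 1 r (s≤s ())
T-growth 2 r (s≤s (s≤s ()))
T-growth j@(suc (suc (suc p))) r _ = subst (λ n → 16 * T n j ≤ T (4 + n) (suc j)) (split p r) (begin
  16 * X                  ≡⟨ double X ⟩
  8 * X + 8 * X           ≤⟨ +-monoʳ-≤ (8 * X) (T-middle s (suc (suc p)) (poly p r)) ⟩
  8 * X + (Y + 24 * Z)    ≡⟨ swap X Y Z ⟩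
  Y + 8 * X + 24 * Z      ≤⟨ T-quadruple-step-≥ n (suc (suc p)) ⟩
  T (4 + n) (suc j)       ∎)
  where
  open ≤-Reasoning
  s = (3 + p) * 3 + r
  n = s + j
  X = T n j
  Y = T n (suc j)
  Z = T n (suc (suc p))
  split : ∀ p r → (3 + p) * 3 + r + (3 + p) ≡ (3 + p) * 4 + r
  split = solve-∀
  double : ∀ x → 16 * x ≡ 8 * x + 8 * x
  double = solve-∀
  swap : ∀ x y z → 8 * x + (y + 24 * z) ≡ y + 8 * x + 24 * z
  swap = solve-∀
  -- The difference of the two sides is a polynomial in p and r with nonnegative coefficients.
  poly : ∀ p r → 16 * (4 + p) * (1 + ((3 + p) * 3 + r))
                 ≤ 4 * (1 + ((3 + p) * 3 + r)) * ((3 + p) * 3 + r) + 24 * (4 + p) * (3 + p)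
  poly p r = ≤-trans (m≤m+n _ (8 + 44 * p + 12 * r + 12 * p * p + 8 * p * r + 4 * r * r)) (≤-reflexive (diff p r))
    where
    diff : ∀ p r → 16 * (4 + p) * (1 + ((3 + p) * 3 + r)) + (8 + 44 * p + 12 * r + 12 * p * p + 8 * p * r + 4 * r * r)
                   ≡ 4 * (1 + ((3 + p) * 3 + r)) * ((3 + p) * 3 + r) + 24 * (4 + p) * (3 + p)
    diff = solve-∀

T-lower-base : ∀ (r : Fin 4) → 15 * 2 ^ (4 * 4 + toℕ r) ≤ 128 * T (4 * 4 + toℕ r) 4
T-lower-base = from-yes (all? λ (r : Fin 4) → 15 * 2 ^ (4 * 4 + toℕ r) ≤? 128 * T (4 * 4 + toℕ r) 4)

T-lower : ∀ {j} (r : Fin 4) → 4 ≤′ j → 15 * 2 ^ (j * 4 + toℕ r) ≤ 128 * T (j * 4 + toℕ r) j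
T-lower r ≤′-refl = T-lower-base r
T-lower {suc j} r (≤′-step 4≤j) = begin
  15 * 2 ^ (suc j * 4 + toℕ r)      ≡⟨ e₁ (2 ^ (j * 4 + toℕ r)) ⟩
  16 * (15 * 2 ^ (j * 4 + toℕ r))   ≤⟨ *-monoʳ-≤ 16 (T-lower r 4≤j) ⟩
  16 * (128 * T (j * 4 + toℕ r) j)  ≡⟨ e₂ (T (j * 4 + toℕ r) j) ⟩
  128 * (16 * T (j * 4 + toℕ r) j)  ≤⟨ *-monoʳ-≤ 128 (T-growth j (toℕ r) (<⇒≤ (≤′⇒≤ 4≤j))) ⟩
  128 * T (suc j * 4 + toℕ r) (suc j)  ∎
  where
  open ≤-Reasoning
  e₁ : ∀ x → 15 * (2 * (2 * (2 * (2 * x)))) ≡ 16 * (15 * x)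
  e₁ = solve-∀
  e₂ : ∀ t → 16 * (128 * t) ≡ 128 * (16 * t)
  e₂ = solve-∀

U-lower-small : ∀ (q r : Fin 4) → 15 * 2 ^ (toℕ q * 4 + toℕ r) ≤ 128 * U (toℕ q * 4 + toℕ r) (toℕ q)
U-lower-small =
  from-yes (all? λ (q : Fin 4) → all? λ (r : Fin 4) →
              15 * 2 ^ (toℕ q * 4 + toℕ r) ≤? 128 * U (toℕ q * 4 + toℕ r) (toℕ q))

U-lower-divMod : ∀ q (r : Fin 4) → 15 * 2 ^ (q * 4 + toℕ r) ≤ 128 * U (q * 4 + toℕ r) q
U-lower-divMod 0 = U-lower-small 0F
U-lower-divMod 1 = U-lower-small 1F
U-lower-divMod 2 = U-lower-small 2F
U-lower-divMod 3 = U-lower-small 3F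
U-lower-divMod q@(suc (suc (suc (suc _)))) r =
  ≤-trans (T-lower {q} r (≤⇒≤′ (s≤s (s≤s (s≤s (s≤s z≤n)))))) (*-monoʳ-≤ 128 (T≤U (q * 4 + toℕ r) q))

U-lower : ∀ z → 15 * 2 ^ z ≤ 128 * U z (z / 4)
U-lower z = subst (λ m → 15 * 2 ^ m ≤ 128 * U m (z / 4)) z≡ (U-lower-divMod (z / 4) (z mod 4))
  where
  z≡ : z / 4 * 4 + toℕ (z mod 4) ≡ z
  z≡ = trans (+-comm (z / 4 * 4) _) (sym (DivMod.property (z divMod 4)))

i+j≤i+k⇒j≤k : ∀ c {i j} → c ℤ.+ i ℤ.≤ c ℤ.+ j → i ℤ.≤ j
i+j≤i+k⇒j≤k c {i} {j} le = subst₂ ℤ._≤_ (cancel c i) (cancel c j) (ℤ.+-monoʳ-≤ (ℤ.- c) le)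
  where
  cancel : ∀ c x → ℤ.- c ℤ.+ (c ℤ.+ x) ≡ x
  cancel = ℤ-solve-∀

InBall : ∀ {n} → Vec Bool n → ℕ → Vec ℤ n → Set
InBall h B x = (sumSq x ℤ.≤ + B) × (∀ i → lookup x i ℤ.%ℕ 2 ≡ bit (lookup h i))

InBall? : ∀ {n} (h : Vec Bool n) B → Decidable (InBall h B)
InBall? h B x = (sumSq x ℤ.≤? + B) ×-dec all? (λ i → lookup x i ℤ.%ℕ 2 ≟ bit (lookup h i))

-- Opaque, so that unification treats points and slice as rigid.
opaque
  points : ∀ {n} → Vec Bool n → ℕ → ℕ → ℕ
  points {n} h B k = count (InBall? h B) (box n k)

  slice : ∀ {n} → Bool → Vec Bool n → ℕ → ℕ → ℤ → ℕ
  slice {n} b h B k a = count (InBall? (b ∷ h) B ∘ (a ∷_)) (box n k)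

  card-S≡points : ∀ d h → card-S d h ≡ points h d d
  card-S≡points d h = refl

  points-[] : ∀ B k → points [] B k ≡ 1
  points-[] B k = refl

  points-∷ : ∀ {n} b (h : Vec Bool n) B k → points (b ∷ h) B k ≡ sum (map (slice b h B k) (range k))
  points-∷ {n} b h B k = trans (count-concatMap P? (λ a → map (a ∷_) (box n k)) (range k))
                               (cong sum (map-cong (λ a → count-map P? (a ∷_) (box n k)) (range k)))
    where
    P? : Decidable (InBall (b ∷ h) B)
    P? = InBall? (b ∷ h) B

  points≤slice : ∀ {n b} {h : Vec Bool n} {B B′ k a} →
                 a ℤ.%ℕ 2 ≡ bit b → a ℤ.* a ℤ.+ + B′ ℤ.≤ + B → points h B′ k ≤ slice b h B k a
  points≤slice {n} {b} {h} {B} {B′} {k} {a} a≡b a²+B′≤B = count-mono _ _ lift (box n k)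
    where
    lift : ∀ {x} → InBall h B′ x → InBall (b ∷ h) B (a ∷ x)
    lift (le , px) = ℤ.≤-trans (ℤ.+-monoʳ-≤ (a ℤ.* a) le) a²+B′≤B
                   , λ { zero → a≡b ; (suc i) → px i }

  slice≤points : ∀ {n b} {h : Vec Bool n} {B B′ k a} →
                 a ℤ.* a ℤ.+ + B′ ≡ + B → slice b h B k a ≤ points h B′ k
  slice≤points {n} {b} {h} {B} {B′} {k} {a} a²+B′≡B = count-mono _ _ drop (box n k)
    where
    drop : ∀ {x} → InBall (b ∷ h) B (a ∷ x) → InBall h B′ x
    drop {x} (le , px) = i+j≤i+k⇒j≤k (a ℤ.* a) (subst (a ℤ.* a ℤ.+ sumSq x ℤ.≤_) (sym a²+B′≡B) le)
                       , px ∘ suc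

  slice≡0 : ∀ {n b} {h : Vec Bool n} {B k a} →
            (∀ {x} → ¬ InBall (b ∷ h) B (a ∷ x)) → slice b h B k a ≡ 0
  slice≡0 {n} {k = k} none = count-none _ none (box n k)

slice≡0-parity : ∀ {n b} {h : Vec Bool n} {B k a} → a ℤ.%ℕ 2 ≢ bit b → slice b h B k a ≡ 0
slice≡0-parity a≢b = slice≡0 (λ (_ , px) → a≢b (px zero))

points≤points-false∷ : ∀ {n} (h : Vec Bool n) B k → points h B k ≤ points (false ∷ h) B k
points≤points-false∷ h B k = begin
  points h B k                  ≤⟨ points≤slice refl ℤ.≤-refl ⟩
  g (+ 0)                       ≤⟨ m≤m+n (g (+ 0)) 0 ⟩
  g (+ 0) + 0                   ≤⟨ sum-⊆-range g {m = 0} {k} ⊆-refl z≤n ⟩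
  sum (map g (range k))         ≡⟨ points-∷ false h B k ⟨
  points (false ∷ h) B k        ∎
  where
  open ≤-Reasoning
  g = slice false h B k

points-false∷-≥ : ∀ {n} (h : Vec Bool n) k {B B′} → 4 + B′ ≤ B →
                  points h B (2 + k) + 2 * points h B′ (2 + k) ≤ points (false ∷ h) B (2 + k)
points-false∷-≥ h k {B} {B′} 4+B′≤B = begin
  p + 2 * p′                              ≡⟨ rearrange p p′ ⟩
  p′ + (p + (p′ + 0))                     ≤⟨ +-mono-≤ (lift -[1+ 1 ] refl refl)
                                                      (+-mono-≤ (points≤slice refl ℤ.≤-refl)
                                                                (+-monoˡ-≤ 0 (lift (+ 2) refl refl))) ⟩
  g -[1+ 1 ] + (g (+ 0) + (g (+ 2) + 0))  ≤⟨ sum-⊆-range g (refl ∷ _ ∷ʳ refl ∷ _ ∷ʳ refl ∷ []) (m≤m+n 2 k) ⟩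
  sum (map g (range (2 + k)))             ≡⟨ points-∷ false h B (2 + k) ⟨
  points (false ∷ h) B (2 + k)            ∎
  where
  open ≤-Reasoning
  p  = points h B (2 + k)
  p′ = points h B′ (2 + k)
  g  = slice false h B (2 + k)
  rearrange : ∀ u v → u + 2 * v ≡ v + (u + (v + 0))
  rearrange = solve-∀
  lift : ∀ a → a ℤ.%ℕ 2 ≡ 0 → a ℤ.* a ≡ + 4 → p′ ≤ g a
  lift a even a²≡4 = points≤slice even (subst (λ c → c ℤ.+ + B′ ℤ.≤ + B) (sym a²≡4) (+≤+ 4+B′≤B))

points-true∷-≥ : ∀ {n} (h : Vec Bool n) B k → 2 * points h B (suc k) ≤ points (true ∷ h) (suc B) (suc k)
points-true∷-≥ h B k = begin
  p + (p + 0)                        ≤⟨ +-mono-≤ (lift -[1+ 0 ] refl refl) (+-monoˡ-≤ 0 (lift (+ 1) refl refl)) ⟩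
  g -[1+ 0 ] + (g (+ 1) + 0)         ≤⟨ sum-⊆-range g (refl ∷ _ ∷ʳ refl ∷ []) (s≤s z≤n) ⟩
  sum (map g (range (suc k)))        ≡⟨ points-∷ true h (suc B) (suc k) ⟨
  points (true ∷ h) (suc B) (suc k)  ∎
  where
  open ≤-Reasoning
  p = points h B (suc k)
  g = slice true h (suc B) (suc k)
  lift : ∀ a → a ℤ.%ℕ 2 ≡ 1 → a ℤ.* a ≡ + 1 → p ≤ g a
  lift a odd a²≡1 = points≤slice odd (ℤ.≤-reflexive (cong (ℤ._+ + B) a²≡1))

zeros : ∀ {n} → Vec Bool n → ℕ
zeros []          = 0
zeros (true ∷ h)  = zeros h
zeros (false ∷ h) = suc (zeros h)

weight+zeros : ∀ {n} (h : Vec Bool n) → weight h + zeros h ≡ n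
weight+zeros []          = refl
weight+zeros (true ∷ h)  = cong suc (weight+zeros h)
weight+zeros (false ∷ h) = trans (+-suc (weight h) (zeros h)) (cong suc (weight+zeros h))

points-lower : ∀ k {n} (h : Vec Bool n) {j B} → j * 4 ≤ B →
               2 ^ weight h * U (zeros h) j ≤ points h (weight h + B) (2 + k)
points-lower k []          {zero}  {B} _ = ≤-reflexive (sym (points-[] B (2 + k)))
points-lower k []          {suc j} {B} _ = ≤-reflexive (sym (points-[] B (2 + k)))
points-lower k (true ∷ h)  {j} {B} j*4≤B = begin
  2 ^ suc w * U z j                        ≡⟨ *-assoc 2 (2 ^ w) (U z j) ⟩
  2 * (2 ^ w * U z j)                      ≤⟨ *-monoʳ-≤ 2 (points-lower k h {j} j*4≤B) ⟩
  2 * points h (w + B) (2 + k)             ≤⟨ points-true∷-≥ h (w + B) (suc k) ⟩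
  points (true ∷ h) (suc (w + B)) (2 + k)  ∎
  where
  open ≤-Reasoning
  w = weight h
  z = zeros h
points-lower k (false ∷ h) {zero} {B} _ =
  ≤-trans (points-lower k h {0} z≤n) (points≤points-false∷ h (weight h + B) (2 + k))
points-lower k (false ∷ h) {suc j} {suc (suc (suc (suc B)))} le@(s≤s (s≤s (s≤s (s≤s j*4≤B)))) = begin
  2 ^ w * (U z (suc j) + 2 * U z j)
    ≡⟨ distrib (2 ^ w) (U z (suc j)) (U z j) ⟩
  2 ^ w * U z (suc j) + 2 * (2 ^ w * U z j)
    ≤⟨ +-mono-≤ (points-lower k h {suc j} le) (*-monoʳ-≤ 2 (points-lower k h {j} j*4≤B)) ⟩
  points h (w + (4 + B)) (2 + k) + 2 * points h (w + B) (2 + k)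
    ≤⟨ points-false∷-≥ h k (≤-reflexive (shift w B)) ⟩
  points (false ∷ h) (w + (4 + B)) (2 + k)
    ∎
  where
  open ≤-Reasoning
  w = weight h
  z = zeros h
  distrib : ∀ p u v → p * (u + 2 * v) ≡ p * u + 2 * (p * v)
  distrib = solve-∀
  shift : ∀ w B → 4 + (w + B) ≡ w + (4 + B)
  shift = solve-∀

15*2^n≤128*points : ∀ k {n} (h : Vec Bool n) → 15 * 2 ^ n ≤ 128 * points h n (2 + k)
15*2^n≤128*points k {n} h = begin
  15 * 2 ^ n                      ≡⟨ cong (λ m → 15 * 2 ^ m) (weight+zeros h) ⟨
  15 * 2 ^ (w + z)                ≡⟨ cong (15 *_) (^-distribˡ-+-* 2 w z) ⟩
  15 * (2 ^ w * 2 ^ z)            ≡⟨ swap 15 (2 ^ w) (2 ^ z) ⟩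
  2 ^ w * (15 * 2 ^ z)            ≤⟨ *-monoʳ-≤ (2 ^ w) (U-lower z) ⟩
  2 ^ w * (128 * U z (z / 4))     ≡⟨ swap (2 ^ w) 128 (U z (z / 4)) ⟩
  128 * (2 ^ w * U z (z / 4))     ≤⟨ *-monoʳ-≤ 128 (points-lower k h {z / 4} (m/n*n≤m z 4)) ⟩
  128 * points h (w + z) (2 + k)  ≡⟨ cong (λ m → 128 * points h m (2 + k)) (weight+zeros h) ⟩
  128 * points h n (2 + k)        ∎
  where
  open ≤-Reasoning
  w = weight h
  z = zeros h
  swap : ∀ a b c → a * (b * c) ≡ b * (a * c)
  swap = solve-∀

ones : ∀ n → Vec Bool n
ones n = replicate n true

weight-ones : ∀ n → weight (ones n) ≡ n
weight-ones zero    = refl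
weight-ones (suc n) = cong suc (weight-ones n)

odd⇒1≤a*a : ∀ a → a ℤ.%ℕ 2 ≡ 1 → + 1 ℤ.≤ a ℤ.* a
odd⇒1≤a*a (+ zero)  ()
odd⇒1≤a*a (+ suc m) _ = +≤+ (s≤s z≤n)
odd⇒1≤a*a -[1+ m ]  _ = +≤+ (s≤s z≤n)

1<∣a∣⇒4≤a*a : ∀ a → 1 < ∣ a ∣ → + 4 ℤ.≤ a ℤ.* a
1<∣a∣⇒4≤a*a (+ 0)           ()
1<∣a∣⇒4≤a*a (+ 1)           (s≤s ())
1<∣a∣⇒4≤a*a -[1+ 0 ]        (s≤s ())
1<∣a∣⇒4≤a*a (+ suc (suc m)) _ = +≤+ (*-mono-≤ {2} {2 + m} {2} (s≤s (s≤s z≤n)) (s≤s (s≤s z≤n)))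
1<∣a∣⇒4≤a*a -[1+ suc m ]    _ = +≤+ (*-mono-≤ {2} {2 + m} {2} (s≤s (s≤s z≤n)) (s≤s (s≤s z≤n)))

n≤sumSq-odd : ∀ {n} (x : Vec ℤ n) → (∀ i → lookup x i ℤ.%ℕ 2 ≡ bit (lookup (ones n) i)) →
              + n ℤ.≤ sumSq x
n≤sumSq-odd []      _   = ℤ.≤-refl
n≤sumSq-odd (a ∷ x) odd = ℤ.+-mono-≤ (odd⇒1≤a*a a (odd zero)) (n≤sumSq-odd x (odd ∘ suc))

slice≡0-1<∣a∣ : ∀ {n b c k a} → c ≤ 2 → 1 < ∣ a ∣ → slice b (ones n) (c + suc n) k a ≡ 0
slice≡0-1<∣a∣ {n} {c = c} {a = a} c≤2 1<∣a∣ = slice≡0 λ { {x} (le , px) →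
  <⇒≱ (s≤s (+-monoˡ-≤ (suc n) c≤2))
      (ℤ.drop‿+≤+ (ℤ.≤-trans (ℤ.+-mono-≤ (1<∣a∣⇒4≤a*a a 1<∣a∣) (n≤sumSq-odd x (px ∘ suc))) le)) }

points-ones≤2^n : ∀ k n {c} → c ≤ 2 → points (ones n) (c + n) (suc k) ≤ 2 ^ n
points-ones≤2^n k zero    {c} _   = ≤-reflexive (points-[] (c + 0) (suc k))
points-ones≤2^n k (suc n) {c} c≤2 = begin
  points (ones (suc n)) (c + suc n) (suc k)
    ≡⟨ points-∷ true (ones n) (c + suc n) (suc k) ⟩
  sum (map g (range (suc k)))
    ≡⟨ sum-range-supported g (λ _ → slice≡0-1<∣a∣ c≤2) (≤⇒≤′ (s≤s z≤n)) ⟩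
  g -[1+ 0 ] + (g (+ 0) + (g (+ 1) + 0))
    ≤⟨ +-mono-≤ (unit -[1+ 0 ] refl) (+-mono-≤ (≤-reflexive (slice≡0-parity λ ())) (+-monoˡ-≤ 0 (unit (+ 1) refl))) ⟩
  2 ^ suc n
    ∎
  where
  open ≤-Reasoning
  g = slice true (ones n) (c + suc n) (suc k)
  unit : ∀ a → a ℤ.* a ≡ + 1 → g a ≤ 2 ^ n
  unit a a²≡1 = ≤-trans (slice≤points (trans (cong (ℤ._+ + (c + n)) a²≡1) (cong +_ (sym (+-suc c n)))))
                        (points-ones≤2^n k n c≤2)

points-false∷ones≤2^n : ∀ k n → points (false ∷ ones n) (suc n) (suc k) ≤ 2 ^ n
points-false∷ones≤2^n k n = begin
  points (false ∷ ones n) (suc n) (suc k)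
    ≡⟨ points-∷ false (ones n) (suc n) (suc k) ⟩
  sum (map g (range (suc k)))
    ≡⟨ sum-range-supported g (λ _ → slice≡0-1<∣a∣ z≤n) (≤⇒≤′ (s≤s z≤n)) ⟩
  g -[1+ 0 ] + (g (+ 0) + (g (+ 1) + 0))
    ≤⟨ +-mono-≤ (≤-reflexive (slice≡0-parity λ ()))
                (+-mono-≤ even (≤-reflexive (cong (_+ 0) (slice≡0-parity λ ())))) ⟩
  2 ^ n + 0
    ≡⟨ +-identityʳ (2 ^ n) ⟩
  2 ^ n
    ∎
  where
  open ≤-Reasoning
  g = slice false (ones n) (suc n) (suc k)
  even : g (+ 0) ≤ 2 ^ n
  even = ≤-trans (slice≤points refl) (points-ones≤2^n k n {1} (s≤s z≤n))

listMin-≤ : ∀ {x xs} → x ∈ xs → listMin xs ≤ x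
listMin-≤ {x} {y ∷ ys} x∈ = foldr-preservesᵒ pres y ys (split x∈)
  where
  pres : ∀ u v → u ≤ x ⊎ v ≤ x → u ⊓ v ≤ x
  pres u v = [ m≤n⇒m⊓o≤n v , m≤n⇒o⊓m≤n u ]′
  split : x ∈ y ∷ ys → y ≤ x ⊎ Any.Any (_≤ x) ys
  split (here x≡y)   = inj₁ (≤-reflexive (sym x≡y))
  split (there x∈ys) = inj₂ (Any.map (λ x≡z → ≤-reflexive (sym x≡z)) x∈ys)

listMin-all : ∀ {ℓ} {P : Pred ℕ ℓ} {x xs} → x ∈ xs → All P xs → P (listMin xs)
listMin-all {P = P} {xs = y ∷ ys} _ (py ∷ pys) = foldr-preservesᵇ pres py pys
  where
  pres : ∀ {u v} → P u → P v → P (u ⊓ v)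
  pres {u} {v} pu pv = [ (λ e → subst P (sym e) pu) , (λ e → subst P (sym e) pv) ]′ (⊓-sel u v)

allBits-complete : ∀ {n} (h : Vec Bool n) → h ∈ allBits n
allBits-complete []                  = here refl
allBits-complete {suc n} (true ∷ h)  = ∈-++⁺ˡ (∈-map⁺ (true ∷_) (allBits-complete h))
allBits-complete {suc n} (false ∷ h) =
  ∈-++⁺ʳ (map (true ∷_) (allBits n)) (∈-++⁺ˡ (∈-map⁺ (false ∷_) (allBits-complete h)))

n%2≢[1+n]%2 : ∀ n → n % 2 ≢ suc n % 2
n%2≢[1+n]%2 zero          ()
n%2≢[1+n]%2 (suc zero)    ()
n%2≢[1+n]%2 (suc (suc n)) = n%2≢[1+n]%2 n

15*2^d≤128*card-S : ∀ k (h : Vec Bool (2 + k)) → 15 * 2 ^ (2 + k) ≤ 2 ^ 7 * card-S (2 + k) h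
15*2^d≤128*card-S k h =
  subst (λ m → 15 * 2 ^ (2 + k) ≤ 128 * m) (sym (card-S≡points (2 + k) h)) (15*2^n≤128*points k h)

card-S-ones≤2^d : ∀ d → card-S (suc d) (ones (suc d)) ≤ 2 ^ suc d
card-S-ones≤2^d d =
  subst (_≤ 2 ^ suc d) (sym (card-S≡points (suc d) (ones (suc d)))) (points-ones≤2^n d (suc d) {0} z≤n)

card-S-false∷ones≤2^d : ∀ d → card-S (suc d) (false ∷ ones d) ≤ 2 ^ suc d
card-S-false∷ones≤2^d d =
  subst (_≤ 2 ^ suc d) (sym (card-S≡points (suc d) (false ∷ ones d)))
        (≤-trans (points-false∷ones≤2^n d d) (m≤m+n (2 ^ d) (2 ^ d + 0)))

ones∈filter-f₀ : ∀ d → ones d ∈ filter (λ h → weight h % 2 ≟ d % 2) (allBits d)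
ones∈filter-f₀ d = ∈-filter⁺ _ (allBits-complete (ones d)) (cong (_% 2) (weight-ones d))

false∷ones∈filter-f₁ : ∀ d →
  false ∷ ones d ∈ filter (λ h → ¬? (weight h % 2 ≟ suc d % 2)) (allBits (suc d))
false∷ones∈filter-f₁ d =
  ∈-filter⁺ _ (allBits-complete (false ∷ ones d))
            (subst (λ w → w % 2 ≢ suc d % 2) (sym (weight-ones d)) (n%2≢[1+n]%2 d))

listMin-card-S-bounds : ∀ k {hs h} → h ∈ hs → card-S (2 + k) h ≤ 2 ^ (2 + k) →
  15 * 2 ^ (2 + k) ≤ 2 ^ 7 * listMin (map (card-S (2 + k)) hs) ×
  listMin (map (card-S (2 + k)) hs) ≤ 2 ^ (2 + k)
listMin-card-S-bounds k {hs} h∈hs upper =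
  listMin-all {P = λ m → 15 * 2 ^ (2 + k) ≤ 2 ^ 7 * m} (∈-map⁺ _ h∈hs)
              (All.map⁺ (All.universal (15*2^d≤128*card-S k) hs)) ,
  ≤-trans (listMin-≤ (∈-map⁺ _ h∈hs)) upper

proposition6p3 : ∀ (d : ℕ) → 1 ≤ d →
    (15 * 2 ^ d ≤ 2 ^ 7 * f₀ d × f₀ d ≤ 2 ^ d) ×
    (15 * 2 ^ d ≤ 2 ^ 7 * f₁ d × f₁ d ≤ 2 ^ d)
-- For d = 1 the box [-1, 1] has no room for the entries ±2 used by points-lower; f₀ 1 = 2 and f₁ 1 = 1.
proposition6p3 1 _ = (≤ᵇ⇒≤ _ _ _ , ≤ᵇ⇒≤ _ _ _) , (≤ᵇ⇒≤ _ _ _ , ≤ᵇ⇒≤ _ _ _)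
proposition6p3 (suc (suc k)) _ =
  listMin-card-S-bounds k (ones∈filter-f₀ (2 + k)) (card-S-ones≤2^d (suc k)) ,
  listMin-card-S-bounds k (false∷ones∈filter-f₁ (suc k)) (card-S-false∷ones≤2^d (suc k))
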